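{- Let $\mathcal{A}=(\Sigma,Q,\delta,\gamma)$ be a UCA schema and let $\mathcal{C}=(\Sigma\times Q, Q', q_0', \delta',\gamma')$ be its collection automaton. Then $\mathcal{C}$ (read as a universal co-Büchi automaton) accepts a word $\varpi=(\sigma_0,q_0)(\sigma_1,q_1)(\sigma_2,q_2)\ldots\in(\Sigma\times Q)^\omega$ if and only if it satisfies all promises, i.e. for every $i\ge 0$, $\sigma_i\sigma_{i+1}\sigma_{i+2}\ldots\in\mathcal{L}(\mathcal{A},q_i)$.
   Context: A UCA schema $\mathcal{A}=(\Sigma,Q,\delta,\gamma)$ has a finite alphabet $\Sigma$, finite state set $Q$, transition function $\delta:Q\times\Sigma\to 2^Q$ and rejecting transitions $\gamma:Q\times\Sigma\to 2^Q$ with $\gamma(q,\sigma)\subseteq\delta(q,\sigma)$; a transition $(q,\sigma,q')$ is rejecting if $q'\in\gamma(q,\sigma)$. A run from $q$ on $w=w_0w_1\ldots$ is a sequence $\rho_0 w_0\rho_1 w_1\ldots$ with $\rho_0=q$ and $\rho_{i}\in\delta(\rho_{i-1},w_{i-1})$; it is rejecting if some rejecting transition occurs infinitely often. $\mathcal{L}(\mathcal{A},q)$ is the set of words having no rejecting run from $q$. The collection automaton is defined with a fresh state $q_0'\notin Q$, $Q'=Q\cup\{q_0'\}$, alphabet $\Sigma\times Q$, initial state $q_0'$, and for all $q,q'\in Q$, $\sigma\in\Sigma$: $\delta'(q,(\sigma,q'))=\delta(q,\sigma)$, $\gamma'(q,(\sigma,q'))=\gamma(q,\sigma)$, $\delta'(q_0',(\sigma,q))=\{q_0'\}\cup\delta(q,\sigma)$,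 and $\gamma'(q_0',(\sigma,q))=\delta(q,\sigma)$ (so the self-loop on $q_0'$ is non-rejecting and all transitions from $q_0'$ into $Q$ are rejecting). $\mathcal{C}$ accepts a word iff it has no rejecting run from $q_0'$. -}

module Defs where

open import Data.Nat using (ℕ; zero; suc; _≤_; _+_)
open import Data.Fin using (Fin)
open import Data.Fin.Subset using (Subset; _∈_; _⊆_)
open import Data.Maybe using (Maybe; just; nothing)
open import Data.Product using (Σ; ∃; _×_; _,_; proj₁; proj₂)
open import Data.Unit using (⊤)
open import Data.Empty using (⊥)
open import Data.Sum using (_⊎_)
open import Relation.Nullary using (¬_)
open import Relation.Binary.PropositionalEquality using (_≡_)

record Schema (s n : ℕ) : Set where
  field
    δ   : Fin n → Fin s → Subset n
    γ   : Fin n → Fin s → Subset n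
    γ⊆δ : ∀ q σ → γ q σ ⊆ δ q σ

record Automaton (A S : Set) : Set₁ where
  field
    trans  : S → A → S → Set
    rejTr  : S → A → S → Set

Word : Set → Set
Word A = ℕ → A

suffix : {A : Set} → Word A → ℕ → Word A
suffix w i k = w (i + k)

module _ {A S : Set} (𝒜 : Automaton A S) where
  open Automaton 𝒜

  IsRun : S → Word A → (ℕ → S) → Set
  IsRun q w ρ = (ρ 0 ≡ q) × (∀ i → trans (ρ i) (w i) (ρ (suc i)))

  -- some rejecting transition occurs infinitely often
  -- (Q and the alphabet are finite, so this is equivalent to: rejecting transitions at infinitely many positions)
  IsRejecting : Word A → (ℕ → S) → Set
  IsRejecting w ρ = ∀ N → ∃ λ i → N ≤ i × rejTr (ρ i) (w i) (ρ (suc i))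

  Accepts : S → Word A → Set
  Accepts q w = ¬ (Σ (ℕ → S) λ ρ → IsRun q w ρ × IsRejecting w ρ)

schemaAut : ∀ {s n} → Schema s n → Automaton (Fin s) (Fin n)
schemaAut 𝒜 = record
  { trans = λ q σ q' → q' ∈ Schema.δ 𝒜 q σ
  ; rejTr = λ q σ q' → q' ∈ Schema.γ 𝒜 q σ }

L : ∀ {s n} → Schema s n → Fin n → Word (Fin s) → Set
L 𝒜 q w = Accepts (schemaAut 𝒜) q w

-- Collection automaton: states Q' = Maybe (Fin n), with q₀' = nothing fresh,
-- alphabet Σ × Q.
q₀' : ∀ {n} → Maybe (Fin n)
q₀' = nothing

δ' : ∀ {s n} → Schema s n → Maybe (Fin n) → Fin s × Fin n → Maybe (Fin n) → Set
δ' 𝒜 (just q) (σ , _)  (just q') = q' ∈ Schema.δ 𝒜 q σ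
δ' 𝒜 (just q) (σ , _)  nothing   = ⊥
δ' 𝒜 nothing  (σ , q)  nothing   = ⊤
δ' 𝒜 nothing  (σ , q)  (just q') = q' ∈ Schema.δ 𝒜 q σ

γ' : ∀ {s n} → Schema s n → Maybe (Fin n) → Fin s × Fin n → Maybe (Fin n) → Set
γ' 𝒜 (just q) (σ , _)  (just q') = q' ∈ Schema.γ 𝒜 q σ
γ' 𝒜 (just q) (σ , _)  nothing   = ⊥
γ' 𝒜 nothing  (σ , q)  nothing   = ⊥
γ' 𝒜 nothing  (σ , q)  (just q') = q' ∈ Schema.δ 𝒜 q σ

collection : ∀ {s n} → Schema s n → Automaton (Fin s × Fin n) (Maybe (Fin n))
collection 𝒜 = record { trans = δ' 𝒜 ; rejTr = γ' 𝒜 }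

CollAccepts : ∀ {s n} → Schema s n → Word (Fin s × Fin n) → Set
CollAccepts 𝒜 ϖ = Accepts (collection 𝒜) q₀' ϖ

SatisfiesPromises : ∀ {s n} → Schema s n → Word (Fin s × Fin n) → Set
SatisfiesPromises 𝒜 ϖ =
  ∀ i → L 𝒜 (proj₂ (ϖ i)) (suffix (λ k → proj₁ (ϖ k)) i)

{-# OPTIONS --safe #-}
module Submission where

open import Defs
open import Data.Nat using (ℕ; zero; suc; _+_; _∸_)
open import Data.Nat.Properties using (m+n≤o⇒n≤o; m+n≤o⇒m≤o∸n; m≤n+m; ≤-trans; m+[n∸m]≡n)
open import Data.Fin using (Fin)
open import Data.Fin.Subset using (_∈_)
open import Data.Maybe using (Maybe; just; nothing)
open import Data.Product using (Σ; ∃; _×_; _,_; proj₁; proj₂)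
open import Data.Unit using (tt)
open import Function using (_∘_)
open import Relation.Nullary using (¬_)
open import Relation.Binary.PropositionalEquality using (_≡_; refl; sym; trans; subst; subst₂)

-- Idea: a run of 𝒞 idles in q₀' on a non-rejecting self-loop and can never return
-- to it once it has entered Q, so a rejecting run of 𝒞 (which must reject
-- infinitely often, hence enter Q) is a run that waits until some position i and
-- then follows a rejecting run of 𝒜 from qᵢ on the i-th suffix; conversely every
-- such run of 𝒜 can be entered this way.

module _ {A S : Set} (𝒜 : Automaton A S) where
  open Automaton 𝒜

  RejectsAt : Word A → (ℕ → S) → ℕ → Set
  RejectsAt w ρ i = rejTr (ρ i) (w i) (ρ (suc i))

  RejectingRun : S → Word A → Set
  RejectingRun q w = Σ (ℕ → S) λ ρ → IsRun 𝒜 q w ρ × IsRejecting 𝒜 w ρ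

IsRejecting-shift : ∀ {A B S T} (𝒜 : Automaton A S) (ℬ : Automaton B T)
  {w : Word A} {ρ : ℕ → S} {v : Word B} {τ : ℕ → T} m n →
  (∀ k → RejectsAt 𝒜 w ρ (m + k) → RejectsAt ℬ v τ (n + k)) →
  IsRejecting 𝒜 w ρ → IsRejecting ℬ v τ
IsRejecting-shift 𝒜 _ {w} {ρ} m n transfer rejecting N
  with rejecting (N + m)
... | i , N+m≤i , rejects-i = n + (i ∸ m) , N≤n+k , transfer (i ∸ m) rejects-m+k
  where
  N≤n+k = ≤-trans (m+n≤o⇒m≤o∸n N N+m≤i) (m≤n+m (i ∸ m) n)
  rejects-m+k = subst (RejectsAt 𝒜 w ρ) (sym (m+[n∸m]≡n (m+n≤o⇒n≤o N N+m≤i))) rejects-i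

module _ {s n : ℕ} (𝒜 : Schema s n) where
  open Schema 𝒜

  private
    𝒞 = collection 𝒜
    𝒜ᵃ = schemaAut 𝒜

  variable
    ϖ : Word (Fin s × Fin n)
    ρ : ℕ → Maybe (Fin n)
    q : Fin n

  letters : Word (Fin s × Fin n) → Word (Fin s)
  letters ϖ k = proj₁ (ϖ k)

  RejectingRun-wait : RejectingRun 𝒞 q₀' (ϖ ∘ suc) → RejectingRun 𝒞 q₀' ϖ
  RejectingRun-wait {ϖ = ϖ} (ρ , (ρ₀ , step) , rejecting) =
    ρ' , (refl , step') , IsRejecting-shift 𝒞 𝒞 0 1 (λ _ r → r) rejecting
    where
    ρ' : ℕ → Maybe (Fin n)
    ρ' zero = nothing
    ρ' (suc k) = ρ k
    step' : ∀ k → δ' 𝒜 (ρ' k) (ϖ k) (ρ' (suc k))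
    step' zero = subst (δ' 𝒜 nothing (ϖ 0)) (sym ρ₀) tt
    step' (suc k) = step k

  RejectingRun-enter : RejectingRun 𝒜ᵃ (proj₂ (ϖ 0)) (letters ϖ) → RejectingRun 𝒞 q₀' ϖ
  RejectingRun-enter {ϖ = ϖ} (ρ , (ρ₀ , step) , rejecting) =
    ρ' , (refl , step') , IsRejecting-shift 𝒜ᵃ 𝒞 1 1 (λ _ r → r) rejecting
    where
    ρ' : ℕ → Maybe (Fin n)
    ρ' zero = nothing
    ρ' (suc k) = just (ρ (suc k))
    step' : ∀ k → δ' 𝒜 (ρ' k) (ϖ k) (ρ' (suc k))
    step' zero = subst (λ q → ρ 1 ∈ δ q (proj₁ (ϖ 0))) ρ₀ (step 0)
    step' (suc k) = step (suc k)

  CollAccepts⇒promise : ∀ i ϖ → CollAccepts 𝒜 ϖ → L 𝒜 (proj₂ (ϖ i)) (suffix (letters ϖ) i)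
  CollAccepts⇒promise zero ϖ accepts = accepts ∘ RejectingRun-enter
  CollAccepts⇒promise (suc i) ϖ accepts =
    CollAccepts⇒promise i (ϖ ∘ suc) (accepts ∘ RejectingRun-wait)

  δ'-stays-in-Q : ∀ {a y} → δ' 𝒜 (just q) a y → ∃ λ p → y ≡ just p
  δ'-stays-in-Q {y = just p} _ = p , refl

  γ'-target-in-Q : ∀ {x a y} → γ' 𝒜 x a y → ∃ λ p → y ≡ just p
  γ'-target-in-Q {just _} {y = just p} _ = p , refl
  γ'-target-in-Q {nothing} {y = just p} _ = p , refl

  run-stays-in-Q : (∀ k → δ' 𝒜 (ρ k) (ϖ k) (ρ (suc k))) →
    ρ 0 ≡ just q → ∀ k → ∃ λ p → ρ k ≡ just p
  run-stays-in-Q step ρ₀ zero = _ , ρ₀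
  run-stays-in-Q {ρ = ρ} {ϖ = ϖ} step ρ₀ (suc k) with run-stays-in-Q step ρ₀ k
  ... | _ , ρₖ = δ'-stays-in-Q (subst (λ x → δ' 𝒜 x (ϖ k) (ρ (suc k))) ρₖ (step k))

  RejectingRun-unwait : IsRun 𝒞 q₀' ϖ ρ → IsRejecting 𝒞 ϖ ρ →
    ρ 1 ≡ nothing → IsRun 𝒞 q₀' (ϖ ∘ suc) (ρ ∘ suc) × IsRejecting 𝒞 (ϖ ∘ suc) (ρ ∘ suc)
  RejectingRun-unwait (_ , step) rejecting ρ₁ =
    (ρ₁ , step ∘ suc) , IsRejecting-shift 𝒞 𝒞 1 0 (λ _ r → r) rejecting

  RejectingRun-unenter : IsRun 𝒞 q₀' ϖ ρ → IsRejecting 𝒞 ϖ ρ →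
    ρ 1 ≡ just q → RejectingRun 𝒜ᵃ (proj₂ (ϖ 0)) (letters ϖ)
  RejectingRun-unenter {ϖ = ϖ} {ρ = ρ} (ρ₀ , step) rejecting ρ₁ =
    ρᵃ , (refl , stepᵃ) , IsRejecting-shift 𝒞 𝒜ᵃ 1 1 rejectsᵃ rejecting
    where
    in-Q : ∀ k → ∃ λ p → ρ (suc k) ≡ just p
    in-Q = run-stays-in-Q (step ∘ suc) ρ₁
    ρᵃ : ℕ → Fin n
    ρᵃ zero = proj₂ (ϖ 0)
    ρᵃ (suc k) = proj₁ (in-Q k)
    lift : ∀ k → ρ (suc k) ≡ just (ρᵃ (suc k))
    lift k = proj₂ (in-Q k)
    stepᵃ : ∀ k → ρᵃ (suc k) ∈ δ (ρᵃ k) (proj₁ (ϖ k))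
    stepᵃ zero = subst₂ (λ x y → δ' 𝒜 x (ϖ 0) y) ρ₀ (lift 0) (step 0)
    stepᵃ (suc k) = subst₂ (λ x y → δ' 𝒜 x (ϖ (suc k)) y) (lift k) (lift (suc k)) (step (suc k))
    rejectsᵃ : ∀ k → RejectsAt 𝒞 ϖ ρ (1 + k) → RejectsAt 𝒜ᵃ (letters ϖ) ρᵃ (1 + k)
    rejectsᵃ k = subst₂ (λ x y → γ' 𝒜 x (ϖ (suc k)) y) (lift k) (lift (suc k))

  rejecting-run-breaks-promise : ∀ j → IsRun 𝒞 q₀' ϖ ρ → IsRejecting 𝒞 ϖ ρ →
    ρ (suc j) ≡ just q → ¬ SatisfiesPromises 𝒜 ϖ
  rejecting-run-breaks-promise {ρ = ρ} j run rejecting ρⱼ₊₁ promises with ρ 1 in ρ₁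
  ... | just _ = promises 0 (RejectingRun-unenter run rejecting ρ₁)
  rejecting-run-breaks-promise zero _ _ ρⱼ₊₁ _ | nothing with () ← trans (sym ρ₁) ρⱼ₊₁
  rejecting-run-breaks-promise (suc j) run rejecting ρⱼ₊₁ promises | nothing
    with run' , rejecting' ← RejectingRun-unwait run rejecting ρ₁ =
    rejecting-run-breaks-promise j run' rejecting' ρⱼ₊₁ (promises ∘ suc)

  promises⇒CollAccepts : ∀ ϖ → SatisfiesPromises 𝒜 ϖ → CollAccepts 𝒜 ϖ
  promises⇒CollAccepts ϖ promises (ρ , run , rejecting)
    with _ , _ , rejects-i ← rejecting 0
    with _ , ρᵢ₊₁ ← γ'-target-in-Q rejects-i =
    rejecting-run-breaks-promise _ run rejecting ρᵢ₊₁ promises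

theorem3 : ∀ {s n : ℕ} (𝒜 : Schema s n) (ϖ : Word (Fin s × Fin n)) →
    (CollAccepts 𝒜 ϖ → SatisfiesPromises 𝒜 ϖ) × (SatisfiesPromises 𝒜 ϖ → CollAccepts 𝒜 ϖ)
theorem3 𝒜 ϖ = (λ accepts i → CollAccepts⇒promise 𝒜 i ϖ accepts) , promises⇒CollAccepts 𝒜 ϖ
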